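{- Let $R$ be a finite ring with unity, let $I$ be a left ideal of $R$, and let $\mathcal{M}_1,\mathcal{M}_2$ be disjoint subsets of $\mathcal{M}_R(I)$. (i) $\mathcal{M}_1$ is a minimal subset of itself if and only if $$\frac{|I|}{\left|\bigcap_{M\in\mathcal{M}_1}M\right|}=\prod_{M\in\mathcal{M}_1}\frac{|I|}{|M|}.$$ (ii) If $\mathcal{M}_R(I)$ is a minimal subset of itself, then for all $E_1\subseteq\mathcal{M}_1$ and all $E_2\subseteq\mathcal{M}_2$, $$\frac{|I|}{\left|\bigcap_{M\in E_1\cup E_2}M\right|}=\frac{|I|}{\left|\bigcap_{M\in E_1}M\right|}\cdot\frac{|I|}{\left|\bigcap_{M\in E_2}M\right|}.$$
   Context: Rings are associative with unity, not necessarily commutative. For a left ideal $J$ of $R$, a maximal $R$-left ideal of $J$ is a left ideal $M$ of $R$ with $M\subsetneq J$ such that there is no left ideal $L$ of $R$ with $M\subsetneq L\subsetneq J$; $\mathcal{M}_R(J)$ denotes the set of all maximal $R$-left ideals of $J$. For $E\subseteq\mathcal{M}_R(J)$, $\bigcap_{M\in E}M$ is the intersection, with the convention that the empty intersection equals $J$. A subset $\mathcal{M}_1\subseteq\mathcal{M}_R(J)$ is called a minimal subset of itself if $\bigcap_{M\in E}M\neq\bigcap_{M\in\mathcal{M}_1}M$ for every proper subset $E\subsetneq\mathcal{M}_1$. -}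

module Defs where

open import Level using (0ℓ)
open import Data.Nat using (ℕ; zero; suc)
open import Data.Integer using (+_)
open import Data.Rational using (ℚ; _/_; _*_; 0ℚ; 1ℚ)
open import Data.Fin using (Fin)
open import Data.Fin.Subset using (Subset; _∩_; ∣_∣) renaming (_∈_ to _∈ₛ_; _⊆_ to _⊆ₛ_)
open import Data.List using (List; []; _∷_; foldr; map)
open import Data.List.Membership.Propositional using () renaming (_∈_ to _∈ₗ_; _∉_ to _∉ₗ_)
open import Data.Product using (_×_; ∃; Σ-syntax)
open import Relation.Binary.PropositionalEquality using (_≡_; _≢_)
open import Relation.Nullary using (¬_)
open import Algebra.Structures using (IsRing)

-- A finite ring, presented (up to isomorphism) on the carrier Fin n,
-- with propositional equality as the ring equality.
record FiniteRing : Set₁ where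
  field
    n     : ℕ
    _+ᴿ_  : Fin n → Fin n → Fin n
    _*ᴿ_  : Fin n → Fin n → Fin n
    -ᴿ_   : Fin n → Fin n
    0ᴿ    : Fin n
    1ᴿ    : Fin n
    isRing : IsRing {A = Fin n} _≡_ _+ᴿ_ _*ᴿ_ -ᴿ_ 0ᴿ 1ᴿ

open FiniteRing public

Sub : FiniteRing → Set
Sub R = Subset (n R)

record IsLeftIdeal (R : FiniteRing) (J : Sub R) : Set where
  field
    zero-mem : 0ᴿ R ∈ₛ J
    +-closed : ∀ x y → x ∈ₛ J → y ∈ₛ J → _+ᴿ_ R x y ∈ₛ J
    neg-closed : ∀ x → x ∈ₛ J → -ᴿ_ R x ∈ₛ J
    left-mul : ∀ r x → x ∈ₛ J → _*ᴿ_ R r x ∈ₛ J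

_⊊_ : ∀ {m} → Subset m → Subset m → Set
A ⊊ B = (A ⊆ₛ B) × (A ≢ B)

IsMaximalIn : (R : FiniteRing) → Sub R → Sub R → Set
IsMaximalIn R J M =
  IsLeftIdeal R M × (M ⊊ J) ×
  (∀ L → IsLeftIdeal R L → M ⊊ L → L ⊊ J → ⊥')
  where
    open import Data.Empty renaming (⊥ to ⊥')

-- Finite sets of subsets are represented as duplicate-free lists.
-- Intersection ⋂_{M∈E} M, with the empty intersection equal to J.
⋂[_] : ∀ {m} → Subset m → List (Subset m) → Subset m
⋂[ J ] []       = J
⋂[ J ] (M ∷ []) = M
⋂[ J ] (M ∷ Es@(_ ∷ _)) = M ∩ ⋂[ J ] Es

_⊆ₗ_ : ∀ {A : Set} → List A → List A → Set
E ⊆ₗ F = ∀ {x} → x ∈ₗ E → x ∈ₗ F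

_⊊ₗ_ : ∀ {A : Set} → List A → List A → Set
E ⊊ₗ F = (E ⊆ₗ F) × ∃ λ x → (x ∈ₗ F) × (x ∉ₗ E)

Disjointₗ : ∀ {A : Set} → List A → List A → Set
Disjointₗ E F = ∀ {x} → x ∈ₗ E → x ∈ₗ F → ⊥'
  where open import Data.Empty renaming (⊥ to ⊥')

MinimalSelf : ∀ {m} → Subset m → List (Subset m) → Set
MinimalSelf J 𝓜₁ = ∀ E → E ⊊ₗ 𝓜₁ → ⋂[ J ] E ≢ ⋂[ J ] 𝓜₁

-- the rational number a / b (b is always positive in the uses below;
-- the value for b = 0 is an irrelevant convention)
_÷_ : ℕ → ℕ → ℚ
a ÷ zero  = 0ℚ
a ÷ suc b = (+ a) / suc b

∏ : List ℚ → ℚ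
∏ = foldr _*_ 1ℚ

{-# OPTIONS --safe #-}
module Submission where

-- For subgroups A, B of a finite abelian group, every z ∈ A + B has exactly |A ∩ B| representations
-- z = a + b, so |A| |B| = |A + B| |A ∩ B|. If M is a maximal left ideal of I and A ⊆ I is a left ideal
-- with A ⊈ M, then M + A = I, so |M| |A| = |I| |M ∩ A|; in general only ≤ holds. Intersecting the members
-- of a list L of maximal ideals one at a time therefore gives |I| ∏ |M| ≤ |I|^|L| |⋂ L|, with equality
-- when no member contains the intersection of the later ones. Minimality of L forces this; conversely,
-- if some E ⊊ L has the same intersection, a member of L outside E can be moved to the front, where it
-- makes the inequality strict. Sublists of a minimal list are minimal, which gives the multiplicativity.

open import Defs

module _ where

  open import Level using (0ℓ)
  open import Algebra.Bundles using (AbelianGroup; Ring)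
  open import Algebra.Core using (Op₁; Op₂)
  open import Algebra.Structures using (IsAbelianGroup)
  open import Data.Bool using (if_then_else_)
  import Data.Bool.Properties as Bool
  open import Data.Empty using (⊥-elim)
  open import Data.Fin using (Fin; zero; suc)
  open import Data.Fin.Permutation using (permutation)
  open import Data.Fin.Properties using (any?)
  open import Data.Fin.Subset using (Subset; inside; outside; _∈_; _⊆_; _⊈_; _⊂_; _∩_; ∣_∣)
  open import Data.Fin.Subset.Properties
    using (_∈?_; ⊆-antisym; ⊆-trans; p∩q⊆p; p∩q⊆q; p⊆q⇒∣p∣≤∣q∣; p⊂q⇒∣p∣<∣q∣; x∈p∩q⁺; x∈p∩q⁻; x∈p⇒∣p-x∣<∣p∣)
  open import Data.Integer using (+_)
  import Data.Integer.Properties as ℤ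
  open import Data.List using (List; []; _∷_; _++_; map; length; filter)
  import Data.List.Properties as List
  open import Data.List.Membership.Propositional using () renaming (_∈_ to _∈ₗ_; _∉_ to _∉ₗ_)
  open import Data.List.Membership.Propositional.Properties
    using (∈-++⁺ˡ; ∈-++⁺ʳ; ∈-++⁻; ∈-filter⁺; ∈-filter⁻; ∈-∃++)
  open import Data.List.Relation.Binary.Disjoint.Propositional using (Disjoint)
  open import Data.List.Relation.Binary.Permutation.Propositional using (_↭_; ↭-sym)
  open import Data.List.Relation.Binary.Permutation.Propositional.Properties
    using (∈-resp-↭; All-resp-↭; ↭-length; shift) renaming (map⁺ to ↭-map⁺)
  open import Data.List.Relation.Binary.Subset.Propositional.Properties using (All-resp-⊇)
  open import Data.List.Relation.Unary.All as All using (All; []; _∷_)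
  open import Data.List.Relation.Unary.All.Properties using (All¬⇒¬Any; map⁺) renaming (++⁺ to All-++⁺)
  open import Data.List.Relation.Unary.AllPairs using ([]; _∷_)
  open import Data.List.Relation.Unary.Any using (here; there)
  open import Data.List.Relation.Unary.Unique.Propositional using (Unique)
  open import Data.List.Relation.Unary.Unique.Propositional.Properties using () renaming (++⁺ to Unique-++⁺)
  open import Data.Nat using (ℕ; zero; suc; pred; _*_; _^_; _≤_; _<_; z≤n; NonZero; >-nonZero)
  import Data.Nat.Properties as ℕ
  open import Data.Nat.ListAction using (product)
  open import Data.Nat.ListAction.Properties using (product≢0; product-↭)
  open import Data.Product using (_×_; _,_; proj₁; proj₂; ∃₂) renaming (map to map×)
  import Data.Rational as ℚ
  open import Data.Rational using (toℚᵘ)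
  import Data.Rational.Properties as ℚ
  open import Data.Rational.Unnormalised using (mkℚᵘ)
  import Data.Rational.Unnormalised as ℚᵘ
  import Data.Rational.Unnormalised.Properties as ℚᵘ
  open import Data.Sum using (_⊎_; inj₁; inj₂)
  open import Data.Unit using (⊤; tt)
  open import Data.Vec using ([]; _∷_) renaming (here to hereᵥ; there to thereᵥ)
  open import Data.Vec.Properties using (≡-dec)
  open import Function.Base using (_∘_; id)
  open import Function.Bundles using (_⇔_; mk⇔; Equivalence)
  open import Relation.Binary.PropositionalEquality
  open import Relation.Nullary using (Dec; yes; no; does; contradiction; _×-dec_)
  open import Relation.Nullary.Decidable using (does-⇔; dec-false; decidable-stable; ¬?)
  open import Relation.Unary using (Pred; Decidable)
  open import Algebra.Properties.CommutativeSemigroup ℕ.*-commutativeSemigroup using (x∙yz≈y∙xz; xy∙z≈y∙xz)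
  open import Algebra.Properties.Semiring.Sum ℕ.+-*-semiring
    using ( sum; sum-syntax; ∑-comm; ∑-permute; sum-cong-≗; sum-replicate-zero
          ; *-distribˡ-sum; *-distribʳ-sum)

  fromPred : ∀ {n} {P : Pred (Fin n) 0ℓ} → Decidable P → Subset n
  fromPred {zero}  P? = []
  fromPred {suc n} P? = does (P? zero) ∷ fromPred (λ x → P? (suc x))

  ∈-fromPred⁺ : ∀ {n} {P : Pred (Fin n) 0ℓ} (P? : Decidable P) {x} → P x → x ∈ fromPred P?
  ∈-fromPred⁺ P? {zero} px with P? zero
  ... | yes _  = hereᵥ
  ... | no ¬px = contradiction px ¬px
  ∈-fromPred⁺ {suc n} P? {suc x} px = thereᵥ (∈-fromPred⁺ (λ y → P? (suc y)) px)

  ∈-fromPred⁻ : ∀ {n} {P : Pred (Fin n) 0ℓ} (P? : Decidable P) {x} → x ∈ fromPred P? → P x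
  ∈-fromPred⁻ P? {zero} x∈ with P? zero | x∈
  ... | yes px | _ = px
  ∈-fromPred⁻ {suc n} P? {suc x} (thereᵥ x∈) = ∈-fromPred⁻ (λ y → P? (suc y)) x∈

  𝟙 : ∀ {A : Set} → Dec A → ℕ
  𝟙 a? = if does a? then 1 else 0

  𝟙-× : ∀ {A B : Set} (a? : Dec A) (b? : Dec B) → 𝟙 a? * 𝟙 b? ≡ 𝟙 (a? ×-dec b?)
  𝟙-× (yes _) (yes _) = refl
  𝟙-× (yes _) (no _)  = refl
  𝟙-× (no _)  _       = refl

  𝟙-cong : ∀ {A B : Set} → A ⇔ B → (a? : Dec A) (b? : Dec B) → 𝟙 a? ≡ 𝟙 b?
  𝟙-cong A⇔B a? b? = cong (λ b → if b then 1 else 0) (does-⇔ A⇔B a? b?)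

  ∣p∣≡∑𝟙 : ∀ {n} (p : Subset n) → ∣ p ∣ ≡ ∑[ x < n ] 𝟙 (x ∈? p)
  ∣p∣≡∑𝟙 []            = refl
  ∣p∣≡∑𝟙 (inside  ∷ p) = cong suc (∣p∣≡∑𝟙 p)
  ∣p∣≡∑𝟙 (outside ∷ p) = ∣p∣≡∑𝟙 p

  infix 4 _≟_
  _≟_ : ∀ {n} (p q : Subset n) → Dec (p ≡ q)
  _≟_ = ≡-dec Bool._≟_

  ⊆∧≢⇒⊂ : ∀ {n} {p q : Subset n} → p ⊆ q → p ≢ q → p ⊂ q
  ⊆∧≢⇒⊂ {p = p} {q} p⊆q p≢q with any? (λ x → x ∈? q ×-dec ¬? (x ∈? p))
  ... | yes witness = p⊆q , witness
  ... | no  none    = contradiction (⊆-antisym p⊆q q⊆p) p≢q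
    where
    q⊆p : q ⊆ p
    q⊆p {x} x∈q = decidable-stable (x ∈? p) (λ x∉p → none (x , x∈q , x∉p))

  ∈⇒∣∣-nonZero : ∀ {m} {p : Subset m} {x} → x ∈ p → NonZero ∣ p ∣
  ∈⇒∣∣-nonZero x∈p = >-nonZero (ℕ.≤-<-trans z≤n (x∈p⇒∣p-x∣<∣p∣ x∈p))

  module FiniteAbelianGroup {n} {_∙_ : Op₂ (Fin n)} {ε : Fin n} {_⁻¹ : Op₁ (Fin n)}
                            (isAbelianGroup : IsAbelianGroup _≡_ _∙_ ε _⁻¹) where

    open IsAbelianGroup isAbelianGroup using (assoc; comm; identityˡ; identityʳ; _-_)
    private
      abelianGroup : AbelianGroup 0ℓ 0ℓ
      abelianGroup = record { isAbelianGroup = isAbelianGroup }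

    open import Algebra.Properties.AbelianGroup abelianGroup
      using (//-rightDividesˡ; //-rightDividesʳ; \\-leftDividesʳ; ⁻¹-anti-homo‿-)

    record IsSubgroup (A : Subset n) : Set where
      field
        ε∈        : ε ∈ A
        ∙-closed  : ∀ {x y} → x ∈ A → y ∈ A → x ∙ y ∈ A
        ⁻¹-closed : ∀ {x} → x ∈ A → x ⁻¹ ∈ A

      -‿closed : ∀ {x y} → x ∈ A → y ∈ A → x - y ∈ A
      -‿closed x∈A y∈A = ∙-closed x∈A (⁻¹-closed y∈A)

      -‿sym : ∀ {x y} → x - y ∈ A → y - x ∈ A
      -‿sym {x} {y} = subst (_∈ A) (⁻¹-anti-homo‿- x y) ∘ ⁻¹-closed

      -‿trans : ∀ {x y w} → x - y ∈ A → y - w ∈ A → x - w ∈ A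
      -‿trans {x} {y} {w} p q = subst (_∈ A) telescope (∙-closed p q)
        where
        telescope : (x - y) ∙ (y - w) ≡ x - w
        telescope = trans (assoc x (y ⁻¹) (y - w)) (cong (x ∙_) (\\-leftDividesʳ y (w ⁻¹)))

      x-y∈A∧y∈A⇒x∈A : ∀ {x y} → x - y ∈ A → y ∈ A → x ∈ A
      x-y∈A∧y∈A⇒x∈A {x} {y} p q = subst (_∈ A) (//-rightDividesˡ y x) (∙-closed p q)

    open IsSubgroup

    infixl 6 _⊞_
    _⊞_ : Subset n → Subset n → Subset n
    A ⊞ B = fromPred (λ z → any? (λ a → a ∈? A ×-dec z - a ∈? B))

    ∈-⊞⁺ : ∀ {A B a b} → a ∈ A → b ∈ B → a ∙ b ∈ A ⊞ B
    ∈-⊞⁺ {A} {B} {a} {b} a∈A b∈B = ∈-fromPred⁺ _ (a , a∈A , subst (_∈ B) (sym a∙b-a≡b) b∈B)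
      where
      a∙b-a≡b : a ∙ b - a ≡ b
      a∙b-a≡b = trans (cong (_- a) (comm a b)) (//-rightDividesʳ a b)

    ∈-⊞⁻ : ∀ {A B z} → z ∈ A ⊞ B → ∃₂ λ a b → a ∈ A × b ∈ B × z ≡ a ∙ b
    ∈-⊞⁻ {A} {B} {z} z∈ with ∈-fromPred⁻ _ z∈
    ... | a , a∈A , z-a∈B = a , z - a , a∈A , z-a∈B , sym a∙[z-a]≡z
      where
      a∙[z-a]≡z : a ∙ (z - a) ≡ z
      a∙[z-a]≡z = trans (comm a (z - a)) (//-rightDividesˡ a z)

    ∑-translate : ∀ a (f : Fin n → ℕ) → sum f ≡ ∑[ x < n ] f (x - a)
    ∑-translate a f = ∑-permute f (permutation (_- a) (_∙ a) (//-rightDividesʳ a) (//-rightDividesˡ a))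

    module _ {A B : Subset n} (A-subgroup : IsSubgroup A) (B-subgroup : IsSubgroup B) where

      open ≡-Reasoning

      -- If z = a₀ ∙ b₀ with a₀ ∈ A and b₀ ∈ B, then a ↦ a - a₀ maps {a ∈ A ∣ z - a ∈ B} onto A ∩ B.
      ∑-fibre : ∀ z → ∑[ a < n ] (𝟙 (a ∈? A) * 𝟙 (z - a ∈? B)) ≡ 𝟙 (z ∈? A ⊞ B) * ∣ A ∩ B ∣
      ∑-fibre z with z ∈? A ⊞ B
      ... | no z∉A⊞B = trans (sum-cong-≗ term≡0) (sum-replicate-zero n)
        where
        term≡0 : ∀ a → 𝟙 (a ∈? A) * 𝟙 (z - a ∈? B) ≡ 0
        term≡0 a = trans (𝟙-× (a ∈? A) (z - a ∈? B)) (cong (λ b → if b then 1 else 0)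
          (dec-false (a ∈? A ×-dec z - a ∈? B)
            λ (a∈A , z-a∈B) → z∉A⊞B (∈-fromPred⁺ _ (a , a∈A , z-a∈B))))
      ... | yes z∈A⊞B with ∈-fromPred⁻ _ z∈A⊞B
      ...   | a₀ , a₀∈A , z-a₀∈B = begin
        ∑[ a < n ] (𝟙 (a ∈? A) * 𝟙 (z - a ∈? B)) ≡⟨ sum-cong-≗ term≡𝟙[a-a₀∈A∩B] ⟩
        ∑[ a < n ] 𝟙 (a - a₀ ∈? A ∩ B)          ≡⟨ ∑-translate a₀ (λ a → 𝟙 (a ∈? A ∩ B)) ⟨
        ∑[ a < n ] 𝟙 (a ∈? A ∩ B)               ≡⟨ ∣p∣≡∑𝟙 (A ∩ B) ⟨
        ∣ A ∩ B ∣                               ≡⟨ ℕ.+-identityʳ _ ⟨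
        1 * ∣ A ∩ B ∣                           ∎
        where
        fibre⇔ : ∀ a → (a ∈ A × z - a ∈ B) ⇔ a - a₀ ∈ A ∩ B
        fibre⇔ a = mk⇔
          (λ (a∈A , z-a∈B) → x∈p∩q⁺ ( -‿closed A-subgroup a∈A a₀∈A
                                    , -‿trans B-subgroup (-‿sym B-subgroup z-a∈B) z-a₀∈B))
          (λ a-a₀∈A∩B → let (a-a₀∈A , a-a₀∈B) = x∈p∩q⁻ A B a-a₀∈A∩B in
                         ( x-y∈A∧y∈A⇒x∈A A-subgroup a-a₀∈A a₀∈A
                         , -‿trans B-subgroup z-a₀∈B (-‿sym B-subgroup a-a₀∈B)))

        term≡𝟙[a-a₀∈A∩B] : ∀ a → 𝟙 (a ∈? A) * 𝟙 (z - a ∈? B) ≡ 𝟙 (a - a₀ ∈? A ∩ B)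
        term≡𝟙[a-a₀∈A∩B] a = trans (𝟙-× (a ∈? A) (z - a ∈? B))
          (𝟙-cong (fibre⇔ a) (a ∈? A ×-dec z - a ∈? B) (a - a₀ ∈? A ∩ B))

      ∣A∣*∣B∣≡∣A⊞B∣*∣A∩B∣ : ∣ A ∣ * ∣ B ∣ ≡ ∣ A ⊞ B ∣ * ∣ A ∩ B ∣
      ∣A∣*∣B∣≡∣A⊞B∣*∣A∩B∣ = begin
        ∣ A ∣ * ∣ B ∣
          ≡⟨ cong (_* ∣ B ∣) (∣p∣≡∑𝟙 A) ⟩
        (∑[ a < n ] 𝟙 (a ∈? A)) * ∣ B ∣
          ≡⟨ *-distribʳ-sum ∣ B ∣ (λ a → 𝟙 (a ∈? A)) ⟩
        ∑[ a < n ] (𝟙 (a ∈? A) * ∣ B ∣)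
          ≡⟨ sum-cong-≗ (λ a → cong (𝟙 (a ∈? A) *_) (trans (∣p∣≡∑𝟙 B) (∑-translate a (λ z → 𝟙 (z ∈? B))))) ⟩
        ∑[ a < n ] (𝟙 (a ∈? A) * ∑[ z < n ] 𝟙 (z - a ∈? B))
          ≡⟨ sum-cong-≗ (λ a → *-distribˡ-sum (𝟙 (a ∈? A)) (λ z → 𝟙 (z - a ∈? B))) ⟩
        ∑[ a < n ] ∑[ z < n ] (𝟙 (a ∈? A) * 𝟙 (z - a ∈? B))
          ≡⟨ ∑-comm (λ a z → 𝟙 (a ∈? A) * 𝟙 (z - a ∈? B)) ⟩
        ∑[ z < n ] ∑[ a < n ] (𝟙 (a ∈? A) * 𝟙 (z - a ∈? B))
          ≡⟨ sum-cong-≗ ∑-fibre ⟩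
        ∑[ z < n ] (𝟙 (z ∈? A ⊞ B) * ∣ A ∩ B ∣)
          ≡⟨ *-distribʳ-sum ∣ A ∩ B ∣ (λ z → 𝟙 (z ∈? A ⊞ B)) ⟨
        (∑[ z < n ] 𝟙 (z ∈? A ⊞ B)) * ∣ A ∩ B ∣
          ≡⟨ cong (_* ∣ A ∩ B ∣) (∣p∣≡∑𝟙 (A ⊞ B)) ⟨
        ∣ A ⊞ B ∣ * ∣ A ∩ B ∣
          ∎

    ⊆-⊞ˡ : ∀ {A B} → ε ∈ B → A ⊆ A ⊞ B
    ⊆-⊞ˡ ε∈B {a} a∈A = subst (_∈ _) (identityʳ a) (∈-⊞⁺ a∈A ε∈B)

    ⊆-⊞ʳ : ∀ {A B} → ε ∈ A → B ⊆ A ⊞ B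
    ⊆-⊞ʳ ε∈A {b} b∈B = subst (_∈ _) (identityˡ b) (∈-⊞⁺ ε∈A b∈B)

    ⊞-least : ∀ {A B C} → IsSubgroup C → A ⊆ C → B ⊆ C → A ⊞ B ⊆ C
    ⊞-least C-subgroup A⊆C B⊆C z∈A⊞B with ∈-⊞⁻ z∈A⊞B
    ... | a , b , a∈A , b∈B , refl = ∙-closed C-subgroup (A⊆C a∈A) (B⊆C b∈B)

    ∣A∣*∣B∣≤∣C∣*∣A∩B∣ : ∀ {A B C} → IsSubgroup A → IsSubgroup B → IsSubgroup C → A ⊆ C → B ⊆ C →
                        ∣ A ∣ * ∣ B ∣ ≤ ∣ C ∣ * ∣ A ∩ B ∣
    ∣A∣*∣B∣≤∣C∣*∣A∩B∣ A-subgroup B-subgroup C-subgroup A⊆C B⊆C = ℕ.≤-trans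
      (ℕ.≤-reflexive (∣A∣*∣B∣≡∣A⊞B∣*∣A∩B∣ A-subgroup B-subgroup))
      (ℕ.*-monoˡ-≤ _ (p⊆q⇒∣p∣≤∣q∣ (⊞-least C-subgroup A⊆C B⊆C)))

  module _ (R : FiniteRing) where

    private
      ring : Ring 0ℓ 0ℓ
      ring = record { isRing = isRing R }

    open Ring ring using (+-isAbelianGroup; +-abelianGroup; +-commutativeSemigroup; distribˡ)
    open import Algebra.Properties.AbelianGroup +-abelianGroup using (⁻¹-∙-comm)
    open import Algebra.Properties.CommutativeSemigroup +-commutativeSemigroup using (interchange)
    open FiniteAbelianGroup +-isAbelianGroup public

    maximal⇒⊆ : ∀ {I M} → IsMaximalIn R I M → M ⊆ I
    maximal⇒⊆ M-maximal = proj₁ (proj₁ (proj₂ M-maximal))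

    IsLeftIdeal⇒IsSubgroup : ∀ {J} → IsLeftIdeal R J → IsSubgroup J
    IsLeftIdeal⇒IsSubgroup J-ideal = record
      { ε∈        = zero-mem
      ; ∙-closed  = +-closed _ _
      ; ⁻¹-closed = neg-closed _
      }
      where open IsLeftIdeal J-ideal

    ∩-isLeftIdeal : ∀ {A B} → IsLeftIdeal R A → IsLeftIdeal R B → IsLeftIdeal R (A ∩ B)
    ∩-isLeftIdeal {A} {B} A-ideal B-ideal = record
      { zero-mem   = x∈p∩q⁺ (IA.zero-mem , IB.zero-mem)
      ; +-closed   = λ x y → ∩-closed₂ (IA.+-closed x y) (IB.+-closed x y)
      ; neg-closed = λ x x∈ → x∈p∩q⁺ (map× (IA.neg-closed x) (IB.neg-closed x) (x∈p∩q⁻ _ _ x∈))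
      ; left-mul   = λ r x x∈ → x∈p∩q⁺ (map× (IA.left-mul r x) (IB.left-mul r x) (x∈p∩q⁻ _ _ x∈))
      }
      where
      module IA = IsLeftIdeal A-ideal
      module IB = IsLeftIdeal B-ideal
      ∩-closed₂ : ∀ {x y z} → (x ∈ A → y ∈ A → z ∈ A) → (x ∈ B → y ∈ B → z ∈ B) →
                  x ∈ A ∩ B → y ∈ A ∩ B → z ∈ A ∩ B
      ∩-closed₂ f g x∈ y∈ with x∈p∩q⁻ _ _ x∈ | x∈p∩q⁻ _ _ y∈
      ... | x∈A , x∈B | y∈A , y∈B = x∈p∩q⁺ (f x∈A y∈A , g x∈B y∈B)

    ⊞-isLeftIdeal : ∀ {A B} → IsLeftIdeal R A → IsLeftIdeal R B → IsLeftIdeal R (A ⊞ B)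
    ⊞-isLeftIdeal {A} {B} A-ideal B-ideal = record
      { zero-mem   = ⊆-⊞ˡ IB.zero-mem IA.zero-mem
      ; +-closed   = λ x y x∈ y∈ → +-closed (∈-⊞⁻ x∈) (∈-⊞⁻ y∈)
      ; neg-closed = λ x x∈ → neg-closed (∈-⊞⁻ x∈)
      ; left-mul   = λ r x x∈ → left-mul r (∈-⊞⁻ x∈)
      }
      where
      module IA = IsLeftIdeal A-ideal
      module IB = IsLeftIdeal B-ideal
      Decomposition : Fin (n R) → Set
      Decomposition z = ∃₂ λ a b → a ∈ A × b ∈ B × z ≡ _+ᴿ_ R a b
      +-closed : ∀ {x y} → Decomposition x → Decomposition y → _+ᴿ_ R x y ∈ A ⊞ B
      +-closed (a , b , a∈A , b∈B , refl) (a′ , b′ , a′∈A , b′∈B , refl) =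
        subst (_∈ A ⊞ B) (sym (interchange a b a′ b′))
          (∈-⊞⁺ (IA.+-closed _ _ a∈A a′∈A) (IB.+-closed _ _ b∈B b′∈B))
      neg-closed : ∀ {x} → Decomposition x → -ᴿ_ R x ∈ A ⊞ B
      neg-closed (a , b , a∈A , b∈B , refl) =
        subst (_∈ A ⊞ B) (⁻¹-∙-comm a b) (∈-⊞⁺ (IA.neg-closed _ a∈A) (IB.neg-closed _ b∈B))
      left-mul : ∀ r {x} → Decomposition x → _*ᴿ_ R r x ∈ A ⊞ B
      left-mul r (a , b , a∈A , b∈B , refl) =
        subst (_∈ A ⊞ B) (sym (distribˡ r a b)) (∈-⊞⁺ (IA.left-mul r a a∈A) (IB.left-mul r b b∈B))

    module _ {I M : Sub R} (M-maximal : IsMaximalIn R I M) where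

      private
        M-ideal : IsLeftIdeal R M
        M-ideal = proj₁ M-maximal
        M⊆I : M ⊆ I
        M⊆I = maximal⇒⊆ M-maximal
        M≢I : M ≢ I
        M≢I = proj₂ (proj₁ (proj₂ M-maximal))

      maximal-sandwich : ∀ {L} → IsLeftIdeal R L → M ⊆ L → L ⊆ I → L ≡ M ⊎ L ≡ I
      maximal-sandwich {L} L-ideal M⊆L L⊆I with L ≟ M | L ≟ I
      ... | yes L≡M | _       = inj₁ L≡M
      ... | no _    | yes L≡I = inj₂ L≡I
      ... | no L≢M  | no L≢I  = ⊥-elim (proj₂ (proj₂ M-maximal) L L-ideal (M⊆L , L≢M ∘ sym) (L⊆I , L≢I))

      maximal-dichotomy : IsLeftIdeal R I → ∀ {A} → IsLeftIdeal R A → A ⊆ I → A ⊆ M ⊎ M ⊞ A ≡ I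
      maximal-dichotomy I-ideal A-ideal A⊆I with maximal-sandwich
        (⊞-isLeftIdeal M-ideal A-ideal)
        (⊆-⊞ˡ (IsLeftIdeal.zero-mem A-ideal))
        (⊞-least (IsLeftIdeal⇒IsSubgroup I-ideal) M⊆I A⊆I)
      ... | inj₁ M⊞A≡M = inj₁ (subst (_ ⊆_) M⊞A≡M (⊆-⊞ʳ (IsLeftIdeal.zero-mem M-ideal)))
      ... | inj₂ M⊞A≡I = inj₂ M⊞A≡I

      ∣M∣*∣A∣≡∣I∣*∣M∩A∣ : IsLeftIdeal R I → ∀ {A} → IsLeftIdeal R A → A ⊆ I → A ⊈ M →
                          ∣ M ∣ * ∣ A ∣ ≡ ∣ I ∣ * ∣ M ∩ A ∣
      ∣M∣*∣A∣≡∣I∣*∣M∩A∣ I-ideal {A} A-ideal A⊆I A⊈M with maximal-dichotomy I-ideal A-ideal A⊆I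
      ... | inj₁ A⊆M   = ⊥-elim (A⊈M A⊆M)
      ... | inj₂ M⊞A≡I = trans
        (∣A∣*∣B∣≡∣A⊞B∣*∣A∩B∣ (IsLeftIdeal⇒IsSubgroup M-ideal) (IsLeftIdeal⇒IsSubgroup A-ideal))
        (cong (λ S → ∣ S ∣ * ∣ M ∩ A ∣) M⊞A≡I)

      ∣M∣<∣I∣ : ∣ M ∣ < ∣ I ∣
      ∣M∣<∣I∣ = p⊂q⇒∣p∣<∣q∣ (⊆∧≢⇒⊂ M⊆I M≢I)

  Irredundant : ∀ {m} → Subset m → List (Subset m) → Set
  Irredundant J []      = ⊤
  Irredundant J (M ∷ L) = ⋂[ J ] L ⊈ M × Irredundant J L

  module _ {m} {J : Subset m} where

    open import Data.List.Membership.DecPropositional (_≟_ {m}) using (_∉?_) renaming (_∈?_ to _∈ₗ?_)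

    ⋂-lowerBound : ∀ {M L} → M ∈ₗ L → ⋂[ J ] L ⊆ M
    ⋂-lowerBound {L = _ ∷ []}        (here refl) = id
    ⋂-lowerBound {L = M ∷ _ ∷ _}     (here refl) = p∩q⊆p M _
    ⋂-lowerBound {L = N ∷ L@(_ ∷ _)} (there M∈L) = ⋂-lowerBound M∈L ∘ p∩q⊆q N (⋂[ J ] L)

    ⋂-⊆ : ∀ {L} → All (_⊆ J) L → ⋂[ J ] L ⊆ J
    ⋂-⊆ []              = id
    ⋂-⊆ {L} (M⊆J ∷ _) = M⊆J ∘ ⋂-lowerBound {L = L} (here refl)

    ⋂-greatest : ∀ {K L} → K ⊆ J → (∀ {M} → M ∈ₗ L → K ⊆ M) → K ⊆ ⋂[ J ] L
    ⋂-greatest {L = []}        K⊆J _   = K⊆J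
    ⋂-greatest {L = _ ∷ []}    _   K⊆L = K⊆L (here refl)
    ⋂-greatest {L = _ ∷ _ ∷ _} K⊆J K⊆L x∈K =
      x∈p∩q⁺ (K⊆L (here refl) x∈K , ⋂-greatest K⊆J (K⊆L ∘ there) x∈K)

    ⋂-antitone : ∀ {E F} → All (_⊆ J) F → E ⊆ₗ F → ⋂[ J ] F ⊆ ⋂[ J ] E
    ⋂-antitone F⊆J E⊆F = ⋂-greatest (⋂-⊆ F⊆J) (λ M∈E → ⋂-lowerBound (E⊆F M∈E))

    ⋂-∷ : ∀ {M L} → M ⊆ J → ⋂[ J ] (M ∷ L) ≡ M ∩ ⋂[ J ] L
    ⋂-∷ {M} {[]}    M⊆J = ⊆-antisym (λ x∈M → x∈p∩q⁺ (x∈M , M⊆J x∈M)) (p∩q⊆p M J)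
    ⋂-∷ {L = _ ∷ _} _   = refl

    ⋂-∷-redundant : ∀ {M L} → All (_⊆ J) (M ∷ L) → ⋂[ J ] L ⊆ M → ⋂[ J ] (M ∷ L) ≡ ⋂[ J ] L
    ⋂-∷-redundant {M} {L} M∷L⊆J@(_ ∷ L⊆J) ⋂L⊆M =
      ⊆-antisym (⋂-antitone M∷L⊆J there) (⋂-greatest (⋂-⊆ L⊆J) below)
      where
      below : ∀ {N} → N ∈ₗ M ∷ L → ⋂[ J ] L ⊆ N
      below (here refl) = ⋂L⊆M
      below (there N∈L) = ⋂-lowerBound N∈L

    ⋂-↭ : ∀ {E F} → All (_⊆ J) E → E ↭ F → ⋂[ J ] E ≡ ⋂[ J ] F
    ⋂-↭ E⊆J E↭F = ⊆-antisym (⋂-antitone E⊆J (∈-resp-↭ (↭-sym E↭F)))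
                            (⋂-antitone (All-resp-↭ E↭F E⊆J) (∈-resp-↭ E↭F))

    MinimalSelf-⊆ : ∀ {L L′} → All (_⊆ J) L → MinimalSelf J L → L′ ⊆ₗ L → MinimalSelf J L′
    MinimalSelf-⊆ {L} {L′} L⊆J L-minimal L′⊆L E (E⊆L′ , x , x∈L′ , x∉E) ⋂E≡⋂L′ =
      L-minimal E′ (E′⊆L , x , L′⊆L x∈L′ , x∉E′) ⋂E′≡⋂L
      where
      E′ : List (Subset m)
      E′ = E ++ filter (_∉? L′) L

      E′⊆L : E′ ⊆ₗ L
      E′⊆L y∈E′ with ∈-++⁻ E y∈E′
      ... | inj₁ y∈E      = L′⊆L (E⊆L′ y∈E)
      ... | inj₂ y∈filter = proj₁ (∈-filter⁻ (_∉? L′) {xs = L} y∈filter)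

      x∉E′ : x ∉ₗ E′
      x∉E′ x∈E′ with ∈-++⁻ E x∈E′
      ... | inj₁ x∈E      = x∉E x∈E
      ... | inj₂ x∈filter = proj₂ (∈-filter⁻ (_∉? L′) {xs = L} x∈filter) x∈L′

      E′⊆J : All (_⊆ J) E′
      E′⊆J = All-resp-⊇ E′⊆L L⊆J

      ⋂E′⊆M : ∀ {M} → M ∈ₗ L → ⋂[ J ] E′ ⊆ M
      ⋂E′⊆M {M} M∈L with M ∈ₗ? L′
      ... | yes M∈L′ = ⊆-trans (⋂-antitone {E} E′⊆J ∈-++⁺ˡ) (subst (_⊆ M) (sym ⋂E≡⋂L′) (⋂-lowerBound M∈L′))
      ... | no  M∉L′ = ⋂-lowerBound (∈-++⁺ʳ E (∈-filter⁺ (_∉? L′) M∈L M∉L′))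

      ⋂E′≡⋂L : ⋂[ J ] E′ ≡ ⋂[ J ] L
      ⋂E′≡⋂L = ⊆-antisym (⋂-greatest (⋂-⊆ E′⊆J) ⋂E′⊆M) (⋂-antitone L⊆J E′⊆L)

    minimal⇒irredundant : ∀ {L} → All (_⊆ J) L → Unique L → MinimalSelf J L → Irredundant J L
    minimal⇒irredundant []                            []                 _           = tt
    minimal⇒irredundant {M ∷ L} M∷L⊆J@(_ ∷ L⊆J) (M≢L ∷ L-unique) M∷L-minimal =
      ⋂L⊈M , minimal⇒irredundant L⊆J L-unique (MinimalSelf-⊆ M∷L⊆J M∷L-minimal there)
      where
      ⋂L⊈M : ⋂[ J ] L ⊈ M
      ⋂L⊈M ⋂L⊆M = M∷L-minimal L (there , M , here refl , All¬⇒¬Any M≢L)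
                               (sym (⋂-∷-redundant M∷L⊆J ⋂L⊆M))

  ∏∣_∣ : ∀ {m} → List (Subset m) → ℕ
  ∏∣ L ∣ = product (map ∣_∣ L)

  ÷-*-÷ : ∀ a b c d .{{_ : NonZero b}} .{{_ : NonZero d}} → (a ÷ b) ℚ.* (c ÷ d) ≡ (a * c) ÷ (b * d)
  -- a ÷ suc b unfolds to fromℚᵘ (mkℚᵘ (+ a) b), and ℚᵘ multiplies numerators and denominators.
  ÷-*-÷ a (suc b) c (suc d) = ℚ.toℚᵘ-injective (begin-equality
    toℚᵘ ((a ÷ suc b) ℚ.* (c ÷ suc d))
      ≃⟨ ℚ.toℚᵘ-homo-* (a ÷ suc b) (c ÷ suc d) ⟩
    toℚᵘ (a ÷ suc b) ℚᵘ.* toℚᵘ (c ÷ suc d)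
      ≃⟨ ℚᵘ.*-cong (ℚ.toℚᵘ-fromℚᵘ (mkℚᵘ (+ a) b)) (ℚ.toℚᵘ-fromℚᵘ (mkℚᵘ (+ c) d)) ⟩
    mkℚᵘ (+ a) b ℚᵘ.* mkℚᵘ (+ c) d
      ≡⟨ cong (λ i → mkℚᵘ i (pred (suc b * suc d))) (ℤ.pos-* a c) ⟨
    mkℚᵘ (+ (a * c)) (pred (suc b * suc d))
      ≃⟨ ℚ.toℚᵘ-fromℚᵘ _ ⟨
    toℚᵘ ((a * c) ÷ (suc b * suc d))
      ∎)
    where open ℚᵘ.≤-Reasoning

  ÷-≡-÷ : ∀ a b c d .{{_ : NonZero b}} .{{_ : NonZero d}} → (a ÷ b ≡ c ÷ d) ⇔ (a * d ≡ c * b)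
  ÷-≡-÷ a (suc b) c (suc d) = mk⇔ (ℚ.normalize-injective-≃ a c (suc b) (suc d))
    (λ ad≡cb → ℚ.fromℚᵘ-cong {mkℚᵘ (+ a) b} {mkℚᵘ (+ c) d}
      (ℚᵘ.*≡* (trans (sym (ℤ.pos-* a (suc d))) (trans (cong +_ ad≡cb) (ℤ.pos-* c (suc b))))))

  ∏-÷ : ∀ {A : Set} a (f : A → ℕ) xs → All (NonZero ∘ f) xs →
        ∏ (map (λ x → a ÷ f x) xs) ≡ (a ^ length xs) ÷ product (map f xs)
  ∏-÷ a f []       []                           = refl
  ∏-÷ a f (x ∷ xs) (fx-nonZero ∷ fxs-nonZero) = trans
    (cong ((a ÷ f x) ℚ.*_) (∏-÷ a f xs fxs-nonZero))
    (÷-*-÷ a (f x) (a ^ length xs) (product (map f xs))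
      {{fx-nonZero}} {{product≢0 (map⁺ fxs-nonZero)}})

  ∏-++ : ∀ xs ys → ∏ (xs ++ ys) ≡ ∏ xs ℚ.* ∏ ys
  ∏-++ []       ys = sym (ℚ.*-identityˡ (∏ ys))
  ∏-++ (x ∷ xs) ys = trans (cong (x ℚ.*_) (∏-++ xs ys)) (sym (ℚ.*-assoc x (∏ xs) (∏ ys)))

  module _ (R : FiniteRing) {I : Sub R} (I-ideal : IsLeftIdeal R I) where

    private
      Maximal : Sub R → Set
      Maximal = IsMaximalIn R I

      All-maximal⇒⊆ : ∀ {L} → All Maximal L → All (_⊆ I) L
      All-maximal⇒⊆ = All.map (maximal⇒⊆ R)

      ideal-nonZero : ∀ {J} → IsLeftIdeal R J → NonZero ∣ J ∣
      ideal-nonZero J-ideal = ∈⇒∣∣-nonZero (IsLeftIdeal.zero-mem J-ideal)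

      instance
        ∣I∣-nonZero : NonZero ∣ I ∣
        ∣I∣-nonZero = ideal-nonZero I-ideal

      ∏∣∣-nonZero : ∀ {L} → All Maximal L → NonZero ∏∣ L ∣
      ∏∣∣-nonZero L-maximal = product≢0 (map⁺ (All.map (ideal-nonZero ∘ proj₁) L-maximal))

      ⋂⊆I : ∀ {L} → All Maximal L → ⋂[ I ] L ⊆ I
      ⋂⊆I L-maximal = ⋂-⊆ (All-maximal⇒⊆ L-maximal)

      ∷-lhs : ∀ (M : Sub R) L → ∣ I ∣ * ∏∣ M ∷ L ∣ ≡ ∣ M ∣ * (∣ I ∣ * ∏∣ L ∣)
      ∷-lhs M L = x∙yz≈y∙xz (∣ I ∣) (∣ M ∣) (∏∣ L ∣)

      ∷-rhs : ∀ {M} L → Maximal M →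
              ∣ I ∣ ^ length (M ∷ L) * ∣ ⋂[ I ] (M ∷ L) ∣ ≡ ∣ I ∣ ^ length L * (∣ I ∣ * ∣ M ∩ ⋂[ I ] L ∣)
      ∷-rhs {M} L M-maximal = trans
        (cong (λ S → ∣ I ∣ ^ length (M ∷ L) * ∣ S ∣) (⋂-∷ {L = L} (maximal⇒⊆ R M-maximal)))
        (xy∙z≈y∙xz ∣ I ∣ (∣ I ∣ ^ length L) (∣ M ∩ ⋂[ I ] L ∣))

    ⋂-isLeftIdeal : ∀ {L} → All Maximal L → IsLeftIdeal R (⋂[ I ] L)
    ⋂-isLeftIdeal []                              = I-ideal
    ⋂-isLeftIdeal {_ ∷ L} (M-maximal ∷ L-maximal) =
      subst (IsLeftIdeal R) (sym (⋂-∷ {L = L} (maximal⇒⊆ R M-maximal)))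
        (∩-isLeftIdeal R (proj₁ M-maximal) (⋂-isLeftIdeal L-maximal))

    product-bound : ∀ {L} → All Maximal L → ∣ I ∣ * ∏∣ L ∣ ≤ ∣ I ∣ ^ length L * ∣ ⋂[ I ] L ∣
    product-bound []                              = ℕ.≤-reflexive (ℕ.*-comm ∣ I ∣ 1)
    product-bound {M ∷ L} (M-maximal ∷ L-maximal) = begin
      ∣ I ∣ * ∏∣ M ∷ L ∣                    ≡⟨ ∷-lhs M L ⟩
      ∣ M ∣ * (∣ I ∣ * ∏∣ L ∣)              ≤⟨ ℕ.*-monoʳ-≤ ∣ M ∣ (product-bound L-maximal) ⟩
      ∣ M ∣ * (∣ I ∣ ^ k * ∣ ⋂[ I ] L ∣)    ≡⟨ x∙yz≈y∙xz (∣ M ∣) (∣ I ∣ ^ k) (∣ ⋂[ I ] L ∣) ⟩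
      ∣ I ∣ ^ k * (∣ M ∣ * ∣ ⋂[ I ] L ∣)    ≤⟨ ℕ.*-monoʳ-≤ (∣ I ∣ ^ k) (∣A∣*∣B∣≤∣C∣*∣A∩B∣ R
                                                  (IsLeftIdeal⇒IsSubgroup R (proj₁ M-maximal))
                                                  (IsLeftIdeal⇒IsSubgroup R (⋂-isLeftIdeal L-maximal))
                                                  (IsLeftIdeal⇒IsSubgroup R I-ideal)
                                                  (maximal⇒⊆ R M-maximal) (⋂⊆I L-maximal)) ⟩
      ∣ I ∣ ^ k * (∣ I ∣ * ∣ M ∩ ⋂[ I ] L ∣) ≡⟨ ∷-rhs L M-maximal ⟨
      ∣ I ∣ ^ length (M ∷ L) * ∣ ⋂[ I ] (M ∷ L) ∣ ∎
      where
      open ℕ.≤-Reasoning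
      k = length L

    ProductFormula : List (Sub R) → Set
    ProductFormula L = ∣ I ∣ * ∏∣ L ∣ ≡ ∣ I ∣ ^ length L * ∣ ⋂[ I ] L ∣

    product-formula : ∀ {L} → All Maximal L → Irredundant I L → ProductFormula L
    product-formula []                              _                       = ℕ.*-comm ∣ I ∣ 1
    product-formula {M ∷ L} (M-maximal ∷ L-maximal) (⋂L⊈M , L-irredundant) = begin
      ∣ I ∣ * ∏∣ M ∷ L ∣                    ≡⟨ ∷-lhs M L ⟩
      ∣ M ∣ * (∣ I ∣ * ∏∣ L ∣)              ≡⟨ cong (∣ M ∣ *_) (product-formula L-maximal L-irredundant) ⟩
      ∣ M ∣ * (∣ I ∣ ^ k * ∣ ⋂[ I ] L ∣)    ≡⟨ x∙yz≈y∙xz (∣ M ∣) (∣ I ∣ ^ k) (∣ ⋂[ I ] L ∣) ⟩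
      ∣ I ∣ ^ k * (∣ M ∣ * ∣ ⋂[ I ] L ∣)    ≡⟨ cong (∣ I ∣ ^ k *_) (∣M∣*∣A∣≡∣I∣*∣M∩A∣ R M-maximal I-ideal
                                                  (⋂-isLeftIdeal L-maximal) (⋂⊆I L-maximal) ⋂L⊈M) ⟩
      ∣ I ∣ ^ k * (∣ I ∣ * ∣ M ∩ ⋂[ I ] L ∣) ≡⟨ ∷-rhs L M-maximal ⟨
      ∣ I ∣ ^ length (M ∷ L) * ∣ ⋂[ I ] (M ∷ L) ∣ ∎
      where
      open ≡-Reasoning
      k = length L

    product-bound-strict : ∀ {M L} → Maximal M → All Maximal L → ⋂[ I ] L ⊆ M →
                           ∣ I ∣ * ∏∣ M ∷ L ∣ < ∣ I ∣ ^ length (M ∷ L) * ∣ ⋂[ I ] (M ∷ L) ∣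
    product-bound-strict {M} {L} M-maximal L-maximal ⋂L⊆M = begin-strict
      ∣ I ∣ * ∏∣ M ∷ L ∣                 ≡⟨ ∷-lhs M L ⟩
      ∣ M ∣ * (∣ I ∣ * ∏∣ L ∣)           <⟨ ℕ.*-monoˡ-< (∣ I ∣ * ∏∣ L ∣) (∣M∣<∣I∣ R M-maximal) ⟩
      ∣ I ∣ * (∣ I ∣ * ∏∣ L ∣)           ≤⟨ ℕ.*-monoʳ-≤ ∣ I ∣ (product-bound L-maximal) ⟩
      ∣ I ∣ * (∣ I ∣ ^ k * ∣ ⋂[ I ] L ∣) ≡⟨ ℕ.*-assoc ∣ I ∣ (∣ I ∣ ^ k) (∣ ⋂[ I ] L ∣) ⟨
      ∣ I ∣ ^ suc k * ∣ ⋂[ I ] L ∣       ≡⟨ cong (λ S → ∣ I ∣ ^ suc k * ∣ S ∣) ⋂[M∷L]≡⋂L ⟨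
      ∣ I ∣ ^ suc k * ∣ ⋂[ I ] (M ∷ L) ∣ ∎
      where
      open ℕ.≤-Reasoning
      k = length L
      ⋂[M∷L]≡⋂L : ⋂[ I ] (M ∷ L) ≡ ⋂[ I ] L
      ⋂[M∷L]≡⋂L = ⋂-∷-redundant (All-maximal⇒⊆ (M-maximal ∷ L-maximal)) ⋂L⊆M
      instance
        ∣I∣*∏∣L∣-nonZero : NonZero (∣ I ∣ * ∏∣ L ∣)
        ∣I∣*∏∣L∣-nonZero = ℕ.m*n≢0 ∣ I ∣ ∏∣ L ∣ {{∣I∣-nonZero}} {{∏∣∣-nonZero L-maximal}}

    ProductFormula-↭ : ∀ {L L′} → All Maximal L → L ↭ L′ → ProductFormula L → ProductFormula L′
    ProductFormula-↭ {L} {L′} L-maximal L↭L′ formula = begin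
      ∣ I ∣ * ∏∣ L′ ∣                      ≡⟨ cong (∣ I ∣ *_) (product-↭ (↭-map⁺ ∣_∣ (↭-sym L↭L′))) ⟩
      ∣ I ∣ * ∏∣ L ∣                       ≡⟨ formula ⟩
      ∣ I ∣ ^ length L * ∣ ⋂[ I ] L ∣      ≡⟨ cong₂ (λ k S → ∣ I ∣ ^ k * ∣ S ∣)
                                                 (↭-length L↭L′) (⋂-↭ (All-maximal⇒⊆ L-maximal) L↭L′) ⟩
      ∣ I ∣ ^ length L′ * ∣ ⋂[ I ] L′ ∣    ∎
      where open ≡-Reasoning

    -- A member x ∉ E of L is redundant, so moving it to the front makes the bound strict.
    formula⇒minimal : ∀ {L} → All Maximal L → ProductFormula L → MinimalSelf I L
    formula⇒minimal L-maximal formula E (E⊆L , x , x∈L , x∉E) ⋂E≡⋂L with ∈-∃++ x∈L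
    ... | xs , ys , refl = ℕ.<-irrefl (ProductFormula-↭ L-maximal L↭x∷L′ formula)
      (product-bound-strict (All.head x∷L′-maximal) (All.tail x∷L′-maximal) ⋂L′⊆x)
      where
      L′ : List (Sub R)
      L′ = xs ++ ys

      L↭x∷L′ : xs ++ x ∷ ys ↭ x ∷ L′
      L↭x∷L′ = shift x xs ys

      x∷L′-maximal : All Maximal (x ∷ L′)
      x∷L′-maximal = All-resp-↭ L↭x∷L′ L-maximal

      E⊆L′ : E ⊆ₗ L′
      E⊆L′ y∈E with ∈-resp-↭ L↭x∷L′ (E⊆L y∈E)
      ... | here refl = ⊥-elim (x∉E y∈E)
      ... | there y∈L′ = y∈L′

      ⋂L′⊆x : ⋂[ I ] L′ ⊆ x
      ⋂L′⊆x = ⊆-trans (⋂-antitone (All-maximal⇒⊆ (All.tail x∷L′-maximal)) E⊆L′)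
                      (subst (_⊆ x) (sym ⋂E≡⋂L) (⋂-lowerBound x∈L))

    ProductFormula⇔÷ : ∀ {L} → All Maximal L →
                       ProductFormula L ⇔ (∣ I ∣ ÷ ∣ ⋂[ I ] L ∣ ≡ ∏ (map (λ M → ∣ I ∣ ÷ ∣ M ∣) L))
    ProductFormula⇔÷ {L} L-maximal = mk⇔
      (λ formula → trans (Equivalence.from cross-multiplied formula) (sym ∏≡))
      (λ ÷-formula → Equivalence.to cross-multiplied (trans ÷-formula ∏≡))
      where
      ∏≡ : ∏ (map (λ M → ∣ I ∣ ÷ ∣ M ∣) L) ≡ (∣ I ∣ ^ length L) ÷ ∏∣ L ∣
      ∏≡ = ∏-÷ ∣ I ∣ ∣_∣ L (All.map (ideal-nonZero ∘ proj₁) L-maximal)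
      cross-multiplied : (∣ I ∣ ÷ ∣ ⋂[ I ] L ∣ ≡ (∣ I ∣ ^ length L) ÷ ∏∣ L ∣) ⇔ ProductFormula L
      cross-multiplied = ÷-≡-÷ ∣ I ∣ ∣ ⋂[ I ] L ∣ (∣ I ∣ ^ length L) ∏∣ L ∣
                           {{ideal-nonZero (⋂-isLeftIdeal L-maximal)}} {{∏∣∣-nonZero L-maximal}}

    minimal⇔÷-formula : ∀ {L} → Unique L → All Maximal L →
                        MinimalSelf I L ⇔ (∣ I ∣ ÷ ∣ ⋂[ I ] L ∣ ≡ ∏ (map (λ M → ∣ I ∣ ÷ ∣ M ∣) L))
    minimal⇔÷-formula L-unique L-maximal = mk⇔
      (Equivalence.to (ProductFormula⇔÷ L-maximal) ∘ product-formula L-maximal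
        ∘ minimal⇒irredundant (All-maximal⇒⊆ L-maximal) L-unique)
      (formula⇒minimal L-maximal ∘ Equivalence.from (ProductFormula⇔÷ L-maximal))

    all-minimal⇒÷-formula : ∀ {𝓜 E} → (∀ M → M ∈ₗ 𝓜 ⇔ Maximal M) → MinimalSelf I 𝓜 →
                            Unique E → All Maximal E →
                            ∣ I ∣ ÷ ∣ ⋂[ I ] E ∣ ≡ ∏ (map (λ M → ∣ I ∣ ÷ ∣ M ∣) E)
    all-minimal⇒÷-formula {𝓜} {E} 𝓜⇔maximal 𝓜-minimal E-unique E-maximal =
      Equivalence.to (minimal⇔÷-formula E-unique E-maximal) (MinimalSelf-⊆ 𝓜⊆I 𝓜-minimal E⊆𝓜)
      where
      𝓜⊆I : All (_⊆ I) 𝓜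
      𝓜⊆I = All.tabulate (maximal⇒⊆ R ∘ Equivalence.to (𝓜⇔maximal _))
      E⊆𝓜 : E ⊆ₗ 𝓜
      E⊆𝓜 M∈E = Equivalence.from (𝓜⇔maximal _) (All.lookup E-maximal M∈E)

    ÷-multiplicative : ∀ {𝓜 E₁ E₂} → (∀ M → M ∈ₗ 𝓜 ⇔ Maximal M) → MinimalSelf I 𝓜 →
                       Unique E₁ → Unique E₂ → Disjoint E₁ E₂ → All Maximal E₁ → All Maximal E₂ →
                       ∣ I ∣ ÷ ∣ ⋂[ I ] (E₁ ++ E₂) ∣ ≡ (∣ I ∣ ÷ ∣ ⋂[ I ] E₁ ∣) ℚ.* (∣ I ∣ ÷ ∣ ⋂[ I ] E₂ ∣)
    ÷-multiplicative {E₁ = E₁} {E₂} 𝓜⇔maximal 𝓜-minimal E₁-unique E₂-unique E₁#E₂ E₁-maximal E₂-maximal =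
      begin
        ∣ I ∣ ÷ ∣ ⋂[ I ] (E₁ ++ E₂) ∣
          ≡⟨ ÷-formula (Unique-++⁺ E₁-unique E₂-unique E₁#E₂) (All-++⁺ E₁-maximal E₂-maximal) ⟩
        ∏ (map f (E₁ ++ E₂))
          ≡⟨ cong ∏ (List.map-++ f E₁ E₂) ⟩
        ∏ (map f E₁ ++ map f E₂)
          ≡⟨ ∏-++ (map f E₁) (map f E₂) ⟩
        ∏ (map f E₁) ℚ.* ∏ (map f E₂)
          ≡⟨ cong₂ ℚ._*_ (÷-formula E₁-unique E₁-maximal) (÷-formula E₂-unique E₂-maximal) ⟨
        (∣ I ∣ ÷ ∣ ⋂[ I ] E₁ ∣) ℚ.* (∣ I ∣ ÷ ∣ ⋂[ I ] E₂ ∣)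
          ∎
      where
      open ≡-Reasoning
      f : Sub R → ℚ.ℚ
      f M = ∣ I ∣ ÷ ∣ M ∣
      ÷-formula : ∀ {E} → Unique E → All Maximal E → ∣ I ∣ ÷ ∣ ⋂[ I ] E ∣ ≡ ∏ (map f E)
      ÷-formula = all-minimal⇒÷-formula 𝓜⇔maximal 𝓜-minimal

open import Data.Fin.Subset using (∣_∣)
open import Data.List using (List; map; _++_)
open import Data.List.Relation.Unary.All using (All)
open import Data.List.Relation.Unary.Unique.Propositional using (Unique)
open import Data.List.Membership.Propositional using (_∈_)
open import Data.Rational using (ℚ; _*_)
open import Data.Product using (_×_; _,_)
open import Function.Bundles using (_⇔_)
open import Relation.Binary.PropositionalEquality using (_≡_)
open import Data.List.Relation.Binary.Subset.Propositional.Properties using (All-resp-⊇)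

lemma2p2 : (R : FiniteRing) (I : Sub R) → IsLeftIdeal R I →
  (𝓜₁ 𝓜₂ : List (Sub R)) → Unique 𝓜₁ → Unique 𝓜₂ →
  All (IsMaximalIn R I) 𝓜₁ → All (IsMaximalIn R I) 𝓜₂ →
  Disjointₗ 𝓜₁ 𝓜₂ →
  (MinimalSelf I 𝓜₁ ⇔
     (∣ I ∣ ÷ ∣ ⋂[ I ] 𝓜₁ ∣ ≡ ∏ (map (λ M → ∣ I ∣ ÷ ∣ M ∣) 𝓜₁)))
  × ((𝓜 : List (Sub R)) → Unique 𝓜 → (∀ M → (M ∈ 𝓜 ⇔ IsMaximalIn R I M)) →
     MinimalSelf I 𝓜 →
     (E₁ E₂ : List (Sub R)) → Unique E₁ → Unique E₂ → E₁ ⊆ₗ 𝓜₁ → E₂ ⊆ₗ 𝓜₂ →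
     ∣ I ∣ ÷ ∣ ⋂[ I ] (E₁ ++ E₂) ∣
       ≡ (∣ I ∣ ÷ ∣ ⋂[ I ] E₁ ∣) * (∣ I ∣ ÷ ∣ ⋂[ I ] E₂ ∣))
lemma2p2 R I I-ideal 𝓜₁ 𝓜₂ 𝓜₁-unique 𝓜₂-unique 𝓜₁-maximal 𝓜₂-maximal 𝓜₁#𝓜₂ =
  minimal⇔÷-formula R I-ideal 𝓜₁-unique 𝓜₁-maximal ,
  λ 𝓜 _ 𝓜⇔maximal 𝓜-minimal E₁ E₂ E₁-unique E₂-unique E₁⊆𝓜₁ E₂⊆𝓜₂ →
    ÷-multiplicative R I-ideal 𝓜⇔maximal 𝓜-minimal E₁-unique E₂-unique
      (λ (M∈E₁ , M∈E₂) → 𝓜₁#𝓜₂ (E₁⊆𝓜₁ M∈E₁) (E₂⊆𝓜₂ M∈E₂))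
      (All-resp-⊇ E₁⊆𝓜₁ 𝓜₁-maximal) (All-resp-⊇ E₂⊆𝓜₂ 𝓜₂-maximal)
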